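{- Let $\Gamma$ be a strongly regular graph with parameters $(v,k,\lambda,\mu)$ and let $\overline{\Gamma}$ be its complement. Then, as polynomials, $$R_{\overline{\Gamma}}(x,y,0)=C_\Gamma(y-x-1,y).$$ In particular, $\mathrm{Rab}_{\geq}(\overline{\Gamma},0)=\mathrm{CAB}(\Gamma)$.
   Context: A graph is strongly regular with parameters $(v,k,\lambda,\mu)$ if it has $v$ vertices, is $k$-regular, is neither complete nor edgeless, every two adjacent vertices have exactly $\lambda$ common neighbours, and every two distinct non-adjacent vertices have exactly $\mu$ common neighbours. Its complement $\overline\Gamma$ is strongly regular with parameters $(v,\ v-k-1,\ v-2-2k+\mu,\ v-2k+\lambda)$. For a strongly regular graph $\Delta$ with parameters $(v',k',\lambda',\mu')$: $R_\Delta(x,y,d)=x(x+1)(v'-y)-2xyk'+(2x+\lambda'-\mu'+1)yd+y(y-1)\mu'-yd^2$; $S_0=\{y\in\{1,\dots,v'\}: R_\Delta(x,y,0)\ge0\text{ for all integers }x\}$; $\mathrm{Rab}_{\geq}(\Delta,0)=\max S_0$ if $S_0\ne\emptyset$, else $0$. For an edge-regular graph $\Gamma$ with parameters $(v,k,\lambda)$ (a $v$-vertex $k$-regular graph with at least one edge in which any two adjacent vertices have exactly $\lambda$ common neighbours), the clique adjacency polynomial is $C_\Gamma(x,y)=(v-y)x(x+1)-2xy(k-y+1)+y(y-1)(\lambda-y+2)$, and the clique adjacency bound $\mathrm{CAB}(\Gamma)$ is the least integer $y\ge2$ such that $C_\Gamma(m,y+1)<0$ for some integer $m$. -}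

module Defs where

open import Data.Nat as ℕ using (ℕ; zero; suc)
open import Data.Integer as ℤ using (ℤ; +_; _+_; _-_; _*_; _≤_; _<_; -_)
open import Data.Bool using (Bool; true; false; _∧_; not; if_then_else_)
open import Data.Fin using (Fin; _≟_)
open import Data.List using (List; map)
open import Data.Nat.ListAction using (sum)
open import Data.List using () renaming (allFin to allFinL)
open import Data.Product using (Σ; ∃; _×_; _,_)
open import Data.Sum using (_⊎_)
open import Relation.Nullary using (¬_; does)
open import Relation.Binary.PropositionalEquality using (_≡_; _≢_)

record Graph (v : ℕ) : Set where
  field
    adj     : Fin v → Fin v → Bool
    symm    : ∀ i j → adj i j ≡ adj j i
    irrefl  : ∀ i → adj i i ≡ false

open Graph public

b2n : Bool → ℕ
b2n true  = 1
b2n false = 0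

countV : ∀ {v} → (Fin v → Bool) → ℕ
countV {v} p = sum (map (λ w → b2n (p w)) (allFinL v))

degree : ∀ {v} → Graph v → Fin v → ℕ
degree G i = countV (λ w → adj G i w)

commonNbrs : ∀ {v} → Graph v → Fin v → Fin v → ℕ
commonNbrs G i j = countV (λ w → adj G i w ∧ adj G j w)

complement : ∀ {v} → Graph v → Graph v
complement {v} G = record
  { adj    = λ i j → not (adj G i j) ∧ not (does (i ≟ j))
  ; symm   = sym'
  ; irrefl = irr
  }
  where
  open import Relation.Binary.PropositionalEquality using (refl; sym; cong₂; cong)
  open import Relation.Nullary using (yes; no)
  open import Data.Bool.Properties using (∧-zeroʳ)
  eqsym : ∀ (i j : Fin v) → does (i ≟ j) ≡ does (j ≟ i)
  eqsym i j with i ≟ j | j ≟ i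
  ... | yes _ | yes _ = refl
  ... | no _  | no _  = refl
  ... | yes p | no q  = Data.Empty.⊥-elim (q (sym p)) where import Data.Empty
  ... | no p  | yes q = Data.Empty.⊥-elim (p (sym q)) where import Data.Empty
  sym' : ∀ i j → (not (adj G i j) ∧ not (does (i ≟ j))) ≡ (not (adj G j i) ∧ not (does (j ≟ i)))
  sym' i j = cong₂ _∧_ (cong not (symm G i j)) (cong not (eqsym i j))
  irr : ∀ i → (not (adj G i i) ∧ not (does (i ≟ i))) ≡ false
  irr i with i ≟ i
  ... | yes _ = ∧-zeroʳ _
  ... | no ¬p = Data.Empty.⊥-elim (¬p refl) where import Data.Empty

record IsSRG {v : ℕ} (G : Graph v) (k lam mu : ℕ) : Set where
  field
    regular      : ∀ i → degree G i ≡ k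
    notEdgeless  : ∃ λ i → ∃ λ j → adj G i j ≡ true
    notComplete  : ∃ λ i → ∃ λ j → i ≢ j × adj G i j ≡ false
    adjCommon    : ∀ i j → adj G i j ≡ true → commonNbrs G i j ≡ lam
    nonadjCommon : ∀ i j → i ≢ j → adj G i j ≡ false → commonNbrs G i j ≡ mu

R : (v' k' lam' mu' : ℕ) → ℤ → ℤ → ℤ → ℤ
R v' k' lam' mu' x y d =
  x * (x + + 1) * (+ v' - y) - + 2 * x * y * + k'
  + (+ 2 * x + + lam' - + mu' + + 1) * y * d
  + y * (y - + 1) * + mu' - y * d * d

C : (v k lam : ℕ) → ℤ → ℤ → ℤ
C v k lam x y =
  (+ v - y) * x * (x + + 1) - + 2 * x * y * (+ k - y + + 1)
  + y * (y - + 1) * (+ lam - y + + 2)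

InS0 : (v' k' lam' mu' : ℕ) → ℕ → Set
InS0 v' k' lam' mu' y =
  (1 ℕ.≤ y) × (y ℕ.≤ v') × (∀ (x : ℤ) → + 0 ≤ R v' k' lam' mu' x (+ y) (+ 0))

IsRab0 : (v' k' lam' mu' : ℕ) → ℕ → Set
IsRab0 v' k' lam' mu' r =
  (InS0 v' k' lam' mu' r × (∀ y → InS0 v' k' lam' mu' y → y ℕ.≤ r))
  ⊎ (r ≡ 0 × (∀ y → ¬ InS0 v' k' lam' mu' y))

IsCAB : (v k lam : ℕ) → ℕ → Set
IsCAB v k lam c =
  (2 ℕ.≤ c)
  × (∃ λ (m : ℤ) → C v k lam m (+ suc c) < + 0)
  × (∀ y → 2 ℕ.≤ y → y ℕ.< c → ∀ (m : ℤ) → + 0 ≤ C v k lam m (+ suc y))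

{-# OPTIONS --safe #-}
module Submission where

open import Defs
open import Data.Nat using (ℕ)
open import Data.Integer using (ℤ; +_; _+_; _-_)
open import Data.Product using (_×_)
open import Function.Bundles using (_⇔_)
open import Relation.Binary.PropositionalEquality using (_≡_)

import Data.Nat as ℕ
import Data.Nat.Properties as ℕ
import Data.Nat.ListAction as List
import Data.Integer.Properties as ℤ
open import Algebra.Properties.CommutativeMonoid.Sum ℕ.+-0-commutativeMonoid
  using (sum-syntax; sum-cong-≗; ∑-distrib-+; sum-replicate-zero)
open import Data.Bool using (Bool; true; false; not; _∧_)
open import Data.Empty using (⊥-elim)
open import Data.Fin using (Fin; _≟_) renaming (zero to fzero; suc to fsuc)
open import Data.Integer using (0ℤ; -[1+_]; _*_; -_; _≤_; _<_; +≤+; -≤+; -<+)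
open import Data.Integer.Tactic.RingSolver using (solve-∀)
open import Data.List using (tabulate)
open import Data.List.Properties using (map-tabulate)
open import Data.Nat using (zero; suc; z≤n; s≤s)
open import Data.Nat.Induction using (<-wellFounded)
open import Data.Product using (∃; _,_; proj₂)
open import Data.Sum using (inj₁; inj₂)
open import Function using (id; _∘_)
open import Function.Bundles using (mk⇔; Equivalence)
open import Induction.WellFounded using (Acc; acc)
open import Relation.Nullary using (¬_; yes; no; does)
open import Relation.Unary using (Pred; Decidable)
open import Relation.Binary.PropositionalEquality
  using (refl; sym; trans; cong; cong₂; subst; subst₂; module ≡-Reasoning)

-- Counting the neighbourhoods of a vertex and of an edge of Γ shows that the
-- complement has k' = v - k - 1 and μ' = v - 2k + λ; with these values the
-- substitution m = y - x - 1 turns R_Γ̄(x, y, 0) into C_Γ(m, y).  So S₀ is the set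
-- of y ≤ v at which C(·, y) is nonnegative, and it remains to see that this set is
-- {1, …, CAB}.  For y ≤ k + 1 only 0 ≤ m < y needs testing (C(m, y) ≥ 0 for m ≥ y,
-- and C(m, y) ≥ C(0, y) for m < 0), and then the identity
--   (1 + y) C(m, y) = m C(m + 1, y + 1) + (y - m - 1) C(m, y + 1) + (y - m - 1)(y - m)(1 + y)
-- passes nonnegativity from y + 1 down to y.  Since C(·, 2) ≥ 0 and C(0, y) < 0 for
-- y ≥ λ + 3, the first y at which it fails exists, exceeds 2, and is CAB + 1.

∑-tabulate : ∀ {n} (f : Fin n → ℕ) → List.sum (tabulate f) ≡ ∑[ w < n ] f w
∑-tabulate {zero}  f = refl
∑-tabulate {suc n} f = cong (f fzero ℕ.+_) (∑-tabulate (f ∘ fsuc))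

countV≡∑ : ∀ {n} (p : Fin n → Bool) → countV p ≡ ∑[ w < n ] b2n (p w)
countV≡∑ p = trans (cong List.sum (map-tabulate id (b2n ∘ p))) (∑-tabulate (b2n ∘ p))

∑-const-1 : ∀ n → ∑[ w < n ] 1 ≡ n
∑-const-1 zero    = refl
∑-const-1 (suc n) = cong suc (∑-const-1 n)

∑-indicator : ∀ {n} (i : Fin n) → ∑[ w < n ] b2n (does (i ≟ w)) ≡ 1
∑-indicator {suc n} fzero    = cong suc (sum-replicate-zero n)
∑-indicator {suc n} (fsuc i) = ∑-indicator i

∑-mono-≤ : ∀ {n} {f g : Fin n → ℕ} → (∀ w → f w ℕ.≤ g w) → ∑[ w < n ] f w ℕ.≤ ∑[ w < n ] g w
∑-mono-≤ {zero}  f≤g = z≤n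
∑-mono-≤ {suc n} f≤g = ℕ.+-mono-≤ (f≤g fzero) (∑-mono-≤ (f≤g ∘ fsuc))

module _ {v : ℕ} (G : Graph v) where

  private
    [_~_] : Fin v → Fin v → ℕ
    [ i ~ w ] = b2n (adj G i w)

    [_≁_] : Fin v → Fin v → ℕ
    [ i ≁ w ] = b2n (adj (complement G) i w)

    [_≡_] : Fin v → Fin v → ℕ
    [ i ≡ w ] = b2n (does (i ≟ w))

    [_~_~_] : Fin v → Fin v → Fin v → ℕ
    [ i ~ j ~ w ] = b2n (adj G i w ∧ adj G j w)

    [_≁_≁_] : Fin v → Fin v → Fin v → ℕ
    [ i ≁ j ≁ w ] = b2n (adj (complement G) i w ∧ adj (complement G) j w)

  adjacent⇒distinct : ∀ {i j} → adj G i j ≡ true → ¬ i ≡ j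
  adjacent⇒distinct {i} i~j refl with trans (sym i~j) (irrefl G i)
  ... | ()

  adjacent⇒complement-nonadjacent : ∀ {i j} → adj G i j ≡ true → adj (complement G) i j ≡ false
  adjacent⇒complement-nonadjacent {i} {j} i~j = cong (λ b → not b ∧ not (does (i ≟ j))) i~j

  neighbour-trichotomy : ∀ i w → [ i ≡ w ] ℕ.+ ([ i ~ w ] ℕ.+ [ i ≁ w ]) ≡ 1
  neighbour-trichotomy i w with i ≟ w
  ... | yes refl rewrite irrefl G i = refl
  ... | no _ with adj G i w
  ...   | true  = refl
  ...   | false = refl

  edge-inclusion-exclusion : ∀ {i j} → adj G i j ≡ true → ∀ w →
    [ i ~ w ] ℕ.+ [ j ~ w ] ℕ.+ [ i ≁ j ≁ w ] ≡ 1 ℕ.+ [ i ~ j ~ w ]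
  edge-inclusion-exclusion {i} {j} i~j w with i ≟ w
  ... | yes refl rewrite irrefl G i | trans (symm G j i) i~j = refl
  ... | no _ with j ≟ w
  ...   | yes refl rewrite irrefl G j | i~j = refl
  ...   | no _ with adj G i w | adj G j w
  ...     | true  | true  = refl
  ...     | true  | false = refl
  ...     | false | true  = refl
  ...     | false | false = refl

  common-neighbour-or-other-end : ∀ {i j} → adj G i j ≡ true → ∀ w →
    [ i ~ j ~ w ] ℕ.+ [ j ≡ w ] ℕ.≤ [ i ~ w ]
  common-neighbour-or-other-end {i} {j} i~j w with j ≟ w
  ... | yes refl rewrite irrefl G j | i~j = ℕ.≤-refl
  ... | no _ with adj G i w | adj G j w
  ...   | true  | true  = ℕ.≤-refl
  ...   | true  | false = z≤n
  ...   | false | true  = z≤n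
  ...   | false | false = z≤n

  degree+degree-complement : ∀ i → suc (degree G i ℕ.+ degree (complement G) i) ≡ v
  degree+degree-complement i = begin
    1 ℕ.+ (degree G i ℕ.+ degree (complement G) i)
      ≡⟨ cong₂ ℕ._+_ (sym (∑-indicator i))
           (cong₂ ℕ._+_ (countV≡∑ (adj G i)) (countV≡∑ (adj (complement G) i))) ⟩
    ∑[ w < v ] [ i ≡ w ] ℕ.+ (∑[ w < v ] [ i ~ w ] ℕ.+ ∑[ w < v ] [ i ≁ w ])
      ≡⟨ cong (∑[ w < v ] [ i ≡ w ] ℕ.+_) (sym (∑-distrib-+ [ i ~_] [ i ≁_])) ⟩
    ∑[ w < v ] [ i ≡ w ] ℕ.+ ∑[ w < v ] ([ i ~ w ] ℕ.+ [ i ≁ w ])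
      ≡⟨ sym (∑-distrib-+ [ i ≡_] (λ w → [ i ~ w ] ℕ.+ [ i ≁ w ])) ⟩
    ∑[ w < v ] ([ i ≡ w ] ℕ.+ ([ i ~ w ] ℕ.+ [ i ≁ w ]))
      ≡⟨ sum-cong-≗ (neighbour-trichotomy i) ⟩
    ∑[ w < v ] 1
      ≡⟨ ∑-const-1 v ⟩
    v ∎
    where open ≡-Reasoning

  degrees+commonNbrs-complement : ∀ {i j} → adj G i j ≡ true →
    degree G i ℕ.+ degree G j ℕ.+ commonNbrs (complement G) i j ≡ v ℕ.+ commonNbrs G i j
  degrees+commonNbrs-complement {i} {j} i~j = begin
    degree G i ℕ.+ degree G j ℕ.+ commonNbrs (complement G) i j
      ≡⟨ cong₂ ℕ._+_ (cong₂ ℕ._+_ (countV≡∑ (adj G i)) (countV≡∑ (adj G j)))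
           (countV≡∑ (λ w → adj (complement G) i w ∧ adj (complement G) j w)) ⟩
    ∑[ w < v ] [ i ~ w ] ℕ.+ ∑[ w < v ] [ j ~ w ] ℕ.+ ∑[ w < v ] [ i ≁ j ≁ w ]
      ≡⟨ cong (ℕ._+ ∑[ w < v ] [ i ≁ j ≁ w ]) (sym (∑-distrib-+ [ i ~_] [ j ~_])) ⟩
    ∑[ w < v ] ([ i ~ w ] ℕ.+ [ j ~ w ]) ℕ.+ ∑[ w < v ] [ i ≁ j ≁ w ]
      ≡⟨ sym (∑-distrib-+ (λ w → [ i ~ w ] ℕ.+ [ j ~ w ]) [ i ≁ j ≁_]) ⟩
    ∑[ w < v ] ([ i ~ w ] ℕ.+ [ j ~ w ] ℕ.+ [ i ≁ j ≁ w ])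
      ≡⟨ sum-cong-≗ (edge-inclusion-exclusion i~j) ⟩
    ∑[ w < v ] (1 ℕ.+ [ i ~ j ~ w ])
      ≡⟨ ∑-distrib-+ (λ _ → 1) [ i ~ j ~_] ⟩
    ∑[ w < v ] 1 ℕ.+ ∑[ w < v ] [ i ~ j ~ w ]
      ≡⟨ cong₂ ℕ._+_ (∑-const-1 v) (sym (countV≡∑ (λ w → adj G i w ∧ adj G j w))) ⟩
    v ℕ.+ commonNbrs G i j ∎
    where open ≡-Reasoning

  commonNbrs<degree : ∀ {i j} → adj G i j ≡ true → commonNbrs G i j ℕ.< degree G i
  commonNbrs<degree {i} {j} i~j = begin
    suc (commonNbrs G i j)
      ≡⟨ ℕ.+-comm 1 (commonNbrs G i j) ⟩
    commonNbrs G i j ℕ.+ 1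
      ≡⟨ cong₂ ℕ._+_ (countV≡∑ (λ w → adj G i w ∧ adj G j w)) (sym (∑-indicator j)) ⟩
    ∑[ w < v ] [ i ~ j ~ w ] ℕ.+ ∑[ w < v ] [ j ≡ w ]
      ≡⟨ sym (∑-distrib-+ [ i ~ j ~_] [ j ≡_]) ⟩
    ∑[ w < v ] ([ i ~ j ~ w ] ℕ.+ [ j ≡ w ])
      ≤⟨ ∑-mono-≤ (common-neighbour-or-other-end i~j) ⟩
    ∑[ w < v ] [ i ~ w ]
      ≡⟨ countV≡∑ (adj G i) ⟨
    degree G i ∎
    where open ℕ.≤-Reasoning

module _ {v k lam mu : ℕ} {G : Graph v} (srg : IsSRG G k lam mu) where

  open IsSRG

  lam<k : lam ℕ.< k
  lam<k with notEdgeless srg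
  ... | i , j , i~j = subst₂ ℕ._<_ (adjCommon srg i j i~j) (regular srg i) (commonNbrs<degree G i~j)

  module _ {k' lam' mu' : ℕ} (srg' : IsSRG (complement G) k' lam' mu') where

    complement-valency : suc (k ℕ.+ k') ≡ v
    complement-valency with notEdgeless srg
    ... | i , _ , _ = subst₂ (λ a b → suc (a ℕ.+ b) ≡ v) (regular srg i) (regular srg' i)
                        (degree+degree-complement G i)

    complement-mu : k ℕ.+ k ℕ.+ mu' ≡ v ℕ.+ lam
    complement-mu with notEdgeless srg
    ... | i , j , i~j = begin
      k ℕ.+ k ℕ.+ mu'
        ≡⟨ cong₂ ℕ._+_ (cong₂ ℕ._+_ (regular srg i) (regular srg j)) mu'-common ⟨
      degree G i ℕ.+ degree G j ℕ.+ commonNbrs (complement G) i j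
        ≡⟨ degrees+commonNbrs-complement G i~j ⟩
      v ℕ.+ commonNbrs G i j
        ≡⟨ cong (v ℕ.+_) (adjCommon srg i j i~j) ⟩
      v ℕ.+ lam ∎
      where
      open ≡-Reasoning
      mu'-common : commonNbrs (complement G) i j ≡ mu'
      mu'-common = nonadjCommon srg' i j (adjacent⇒distinct G i~j)
                     (adjacent⇒complement-nonadjacent G i~j)

-- C v k lam and R v k' lam' mu' with integer parameters; INLINE lets solve-∀ see
-- the polynomials, and C v k lam ≡ Cℤ (+ v) (+ k) (+ lam) holds definitionally.
Cℤ : ℤ → ℤ → ℤ → ℤ → ℤ → ℤ
Cℤ V K L x y = (V - y) * x * (x + + 1) - + 2 * x * y * (K - y + + 1) + y * (y - + 1) * (L - y + + 2)
{-# INLINE Cℤ #-}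

Rℤ : ℤ → ℤ → ℤ → ℤ → ℤ → ℤ → ℤ → ℤ
Rℤ V K' L' M' x y d =
  x * (x + + 1) * (V - y) - + 2 * x * y * K' + (+ 2 * x + L' - M' + + 1) * y * d
  + y * (y - + 1) * M' - y * d * d
{-# INLINE Rℤ #-}

R-complement≡C : ∀ V K L L' x y →
  Rℤ V (V - K - + 1) L' (V - + 2 * K + L) x y 0ℤ ≡ Cℤ V K L (y - x - + 1) y
R-complement≡C = solve-∀

C-above-expansion : ∀ V K L m y → Cℤ V K L m y ≡
  (V - y) * ((m - y) * (m - y + + 1)) + + 2 * (m + + 1 - y) * y * (V - K - + 1)
  + (y - + 1) * (y - + 1 + + 1) * (V - + 2 * K + L)
C-above-expansion = solve-∀

C-below-expansion : ∀ V K L m y → Cℤ V K L m y ≡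
  (V - y) * (m * (m + + 1)) + + 2 * (- m) * y * (+ 1 + K - y) + Cℤ V K L 0ℤ y
C-below-expansion = solve-∀

C-zero-expansion : ∀ V K L T → Cℤ V K L 0ℤ (+ 3 + L + T) ≡
  - ((+ 3 + L + T) * (+ 2 + L + T) * (+ 1 + T))
C-zero-expansion = solve-∀

C-two-expansion : ∀ V K L m → Cℤ V K L m (+ 2) ≡
  (V - + 2 * K + L) * (m * (m + + 1)) + + 2 * (K - L - + 1) * ((m - + 1) * (m - + 1 + + 1))
  + L * ((m - + 2) * (m - + 2 + + 1))
C-two-expansion = solve-∀

C-step-identity : ∀ V K L m y → (+ 1 + y) * Cℤ V K L m y ≡
  m * Cℤ V K L (+ 1 + m) (+ 1 + y) + (y - m - + 1) * Cℤ V K L m (+ 1 + y)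
  + (y - m - + 1) * (y - m - + 1 + + 1) * (+ 1 + y)
C-step-identity = solve-∀

0≤+ : ∀ n → 0ℤ ≤ + n
0≤+ _ = +≤+ z≤n

+-nonNeg : ∀ {i j} → 0ℤ ≤ i → 0ℤ ≤ j → 0ℤ ≤ i + j
+-nonNeg = ℤ.+-mono-≤

*-nonNeg : ∀ {i j} → 0ℤ ≤ i → 0ℤ ≤ j → 0ℤ ≤ i * j
*-nonNeg (+≤+ {n = m} _) (+≤+ {n = n} _) = subst (0ℤ ≤_) (ℤ.pos-* m n) (0≤+ (m ℕ.* n))

i*[i+1]-nonNeg : ∀ i → 0ℤ ≤ i * (i + + 1)
i*[i+1]-nonNeg (+ n)        = *-nonNeg (0≤+ n) (0≤+ (n ℕ.+ 1))
i*[i+1]-nonNeg -[1+ zero ]  = 0≤+ 0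
i*[i+1]-nonNeg -[1+ suc n ] = 0≤+ _

j≤i+j : ∀ {i} j → 0ℤ ≤ i → j ≤ i + j
j≤i+j {i} j 0≤i = subst (_≤ i + j) (ℤ.+-identityˡ j) (ℤ.+-monoˡ-≤ j 0≤i)

module _ {p} {P : Pred ℕ p} (P? : Decidable P) where

  least : ∀ {n} → P n → ∃ λ m → P m × (∀ {j} → j ℕ.< m → ¬ P j)
  least {n} = go n (<-wellFounded n)
    where
    go : ∀ n → Acc ℕ._<_ n → P n → ∃ λ m → P m × (∀ {j} → j ℕ.< m → ¬ P j)
    go n (acc below) Pn with ℕ.anyUpTo? P? n
    ... | yes (j , j<n , Pj) = go j (below j<n) Pj
    ... | no ¬smaller        = n , Pn , λ j<n Pj → ¬smaller (_ , j<n , Pj)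

module CliqueAdjacency {v k lam : ℕ}
  (lam<k : lam ℕ.< k) (k<v : k ℕ.< v) (k+k≤v+lam : k ℕ.+ k ℕ.≤ v ℕ.+ lam) where

  NonNegC : ℕ → Set
  NonNegC y = ∀ m → 0ℤ ≤ C v k lam m (+ y)

  NegC : ℕ → Set
  NegC y = ∃ λ m → C v k lam m (+ y) < 0ℤ

  nonNegC⇒¬negC : ∀ {y} → NonNegC y → ¬ NegC y
  nonNegC⇒¬negC nonNeg (m , neg) = ℤ.≤⇒≯ (nonNeg m) neg

  ¬negC⇒nonNegC : ∀ {y} → ¬ NegC y → NonNegC y
  ¬negC⇒nonNegC ¬neg m = ℤ.≮⇒≥ (λ neg → ¬neg (m , neg))

  2+lam≤1+k : 2 ℕ.+ lam ℕ.≤ suc k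
  2+lam≤1+k = s≤s lam<k

  0≤v-k-1 : 0ℤ ≤ + v - + k - + 1
  0≤v-k-1 = subst (0ℤ ≤_) (shift (+ v) (+ k)) (ℤ.i≤j⇒0≤j-i (+≤+ k<v))
    where
    shift : ∀ V K → V - (+ 1 + K) ≡ V - K - + 1
    shift = solve-∀

  0≤v-2k+lam : 0ℤ ≤ + v - + 2 * + k + + lam
  0≤v-2k+lam = subst (0ℤ ≤_) (regroup (+ v) (+ k) (+ lam)) (ℤ.i≤j⇒0≤j-i (+≤+ k+k≤v+lam))
    where
    regroup : ∀ V K L → V + L - (K + K) ≡ V - + 2 * K + L
    regroup = solve-∀

  0≤k-lam-1 : 0ℤ ≤ + k - + lam - + 1
  0≤k-lam-1 = subst (0ℤ ≤_) (shift (+ k) (+ lam)) (ℤ.i≤j⇒0≤j-i (+≤+ lam<k))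
    where
    shift : ∀ K L → K - (+ 1 + L) ≡ K - L - + 1
    shift = solve-∀

  C-nonNeg-above : ∀ {y m} → y ℕ.≤ v → + y ≤ m → 0ℤ ≤ C v k lam m (+ y)
  C-nonNeg-above {y} {m} y≤v y≤m =
    subst (0ℤ ≤_) (sym (C-above-expansion (+ v) (+ k) (+ lam) m (+ y)))
      (+-nonNeg (+-nonNeg
        (*-nonNeg (ℤ.i≤j⇒0≤j-i (+≤+ y≤v)) (i*[i+1]-nonNeg (m - + y)))
        (*-nonNeg (*-nonNeg (*-nonNeg (0≤+ 2) 0≤m+1-y) (0≤+ y)) 0≤v-k-1))
        (*-nonNeg (i*[i+1]-nonNeg (+ y - + 1)) 0≤v-2k+lam))
    where
    0≤m+1-y : 0ℤ ≤ m + + 1 - + y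
    0≤m+1-y = ℤ.i≤j⇒0≤j-i (ℤ.≤-trans y≤m (ℤ.i≤i+j m (+ 1)))

  C-zero≤C-nonPos : ∀ {y m} → y ℕ.≤ suc k → m ≤ 0ℤ → C v k lam 0ℤ (+ y) ≤ C v k lam m (+ y)
  C-zero≤C-nonPos {y} {m} y≤k+1 m≤0 =
    subst (C v k lam 0ℤ (+ y) ≤_) (sym (C-below-expansion (+ v) (+ k) (+ lam) m (+ y)))
      (j≤i+j _ (+-nonNeg
        (*-nonNeg (ℤ.i≤j⇒0≤j-i (+≤+ (ℕ.≤-trans y≤k+1 k<v))) (i*[i+1]-nonNeg m))
        (*-nonNeg (*-nonNeg (*-nonNeg (0≤+ 2) (ℤ.neg-mono-≤ m≤0)) (0≤+ y))
          (ℤ.i≤j⇒0≤j-i (+≤+ y≤k+1)))))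

  nonNegC-from-below : ∀ {y} → y ℕ.≤ suc k →
    (∀ {a} → a ℕ.< y → 0ℤ ≤ C v k lam (+ a) (+ y)) → NonNegC y
  nonNegC-from-below {y} y≤k+1 below (+ a) with a ℕ.<? y
  ... | yes a<y = below a<y
  ... | no a≮y  = C-nonNeg-above (ℕ.≤-trans y≤k+1 k<v) (+≤+ (ℕ.≮⇒≥ a≮y))
  nonNegC-from-below y≤k+1 below -[1+ n ] =
    ℤ.≤-trans (nonNegC-from-below y≤k+1 below 0ℤ) (C-zero≤C-nonPos y≤k+1 -≤+)

  C-zero-neg : ∀ {y} → 3 ℕ.+ lam ℕ.≤ y → C v k lam 0ℤ (+ y) < 0ℤ
  C-zero-neg 3+lam≤y with ℕ.m≤n⇒∃[o]m+o≡n 3+lam≤y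
  ... | t , refl = subst (_< 0ℤ) (sym (C-zero-expansion (+ v) (+ k) (+ lam) (+ t))) -<+

  negC-large : ∀ {y} → 3 ℕ.+ lam ℕ.≤ y → NegC y
  negC-large 3+lam≤y = 0ℤ , C-zero-neg 3+lam≤y

  nonNegC-bounded : ∀ {y} → NonNegC y → y ℕ.≤ 2 ℕ.+ lam
  nonNegC-bounded {y} nonNeg with y ℕ.≤? 2 ℕ.+ lam
  ... | yes y≤2+lam = y≤2+lam
  ... | no y≰2+lam  = ⊥-elim (nonNegC⇒¬negC {y} nonNeg (negC-large (ℕ.≰⇒> y≰2+lam)))

  C-nonNeg-step : ∀ {a y} → a ℕ.< y →
    0ℤ ≤ C v k lam (+ suc a) (+ suc y) → 0ℤ ≤ C v k lam (+ a) (+ suc y) →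
    0ℤ ≤ C v k lam (+ a) (+ y)
  C-nonNeg-step {a} {y} a<y next same =
    ℤ.*-cancelˡ-≤-pos 0ℤ (C v k lam (+ a) (+ y)) (+ suc y)
      (subst₂ _≤_ (sym (ℤ.*-zeroʳ (+ suc y))) (sym (C-step-identity (+ v) (+ k) (+ lam) (+ a) (+ y)))
        (+-nonNeg (+-nonNeg (*-nonNeg (0≤+ a) next) (*-nonNeg 0≤y-a-1 same))
          (*-nonNeg (i*[i+1]-nonNeg (+ y - + a - + 1)) (0≤+ (suc y)))))
    where
    shift : ∀ Y A → Y - (+ 1 + A) ≡ Y - A - + 1
    shift = solve-∀
    0≤y-a-1 : 0ℤ ≤ + y - + a - + 1
    0≤y-a-1 = subst (0ℤ ≤_) (shift (+ y) (+ a)) (ℤ.i≤j⇒0≤j-i (+≤+ a<y))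

  nonNegC-pred : ∀ {y} → NonNegC (suc y) → NonNegC y
  nonNegC-pred {y} nonNeg =
    nonNegC-from-below y≤k+1 (λ a<y → C-nonNeg-step a<y (nonNeg _) (nonNeg _))
    where
    y≤k+1 : y ℕ.≤ suc k
    y≤k+1 = ℕ.m≤n⇒m≤1+n (ℕ.≤-pred (ℕ.≤-trans (nonNegC-bounded {suc y} nonNeg) 2+lam≤1+k))

  nonNegC-antitone : ∀ {y z} → z ℕ.≤ y → NonNegC y → NonNegC z
  nonNegC-antitone z≤y = go (ℕ.≤⇒≤′ z≤y)
    where
    go : ∀ {y z} → z ℕ.≤′ y → NonNegC y → NonNegC z
    go ℕ.≤′-refl        nonNeg = nonNeg
    go (ℕ.≤′-step z≤′y) nonNeg = go z≤′y (nonNegC-pred nonNeg)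

  nonNegC-2 : NonNegC 2
  nonNegC-2 m = subst (0ℤ ≤_) (sym (C-two-expansion (+ v) (+ k) (+ lam) m))
    (+-nonNeg
      (+-nonNeg (*-nonNeg 0≤v-2k+lam (i*[i+1]-nonNeg m))
                (*-nonNeg (*-nonNeg (0≤+ 2) 0≤k-lam-1) (i*[i+1]-nonNeg (m - + 1))))
      (*-nonNeg (0≤+ lam) (i*[i+1]-nonNeg (m - + 2))))

  negC? : Decidable NegC
  negC? y with 3 ℕ.+ lam ℕ.≤? y
  ... | yes 3+lam≤y = yes (negC-large 3+lam≤y)
  ... | no 3+lam≰y with ℕ.anyUpTo? (λ a → C v k lam (+ a) (+ y) ℤ.<? 0ℤ) y
  ...   | yes (a , _ , neg) = yes (+ a , neg)
  ...   | no ¬below = no (nonNegC⇒¬negC {y} (nonNegC-from-below y≤k+1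
            (λ {a} a<y → ℤ.≮⇒≥ (λ neg → ¬below (a , a<y , neg)))))
    where
    y≤k+1 : y ℕ.≤ suc k
    y≤k+1 = ℕ.≤-trans (ℕ.≤-pred (ℕ.≰⇒> 3+lam≰y)) 2+lam≤1+k

  cab-exists : ∃ (IsCAB v k lam)
  cab-exists with least (λ c → negC? (suc c)) (negC-large {3 ℕ.+ lam} ℕ.≤-refl)
  ... | c , negC[1+c] , ¬negC-below = c , 2≤c , negC[1+c] ,
                                      λ y _ y<c → ¬negC⇒nonNegC {suc y} (¬negC-below y<c)
    where
    2≤c : 2 ℕ.≤ c
    2≤c = ℕ.≮⇒≥ (λ c<2 → nonNegC⇒¬negC {suc c} (nonNegC-antitone c<2 nonNegC-2) negC[1+c])

  cab-nonNegC : ∀ {c} → IsCAB v k lam c → NonNegC c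
  cab-nonNegC {1}                 (s≤s () , _)
  cab-nonNegC {2}                 _              = nonNegC-2
  cab-nonNegC {suc (suc (suc c))} (_ , _ , good) = good (2 ℕ.+ c) (s≤s (s≤s z≤n)) ℕ.≤-refl

  cab-maximal : ∀ {c y} → IsCAB v k lam c → NonNegC y → y ℕ.≤ c
  cab-maximal {c} (_ , negC[1+c] , _) nonNeg =
    ℕ.≮⇒≥ (λ c<y → nonNegC⇒¬negC {suc c} (nonNegC-antitone c<y nonNeg) negC[1+c])

module _ {v k lam k' lam' mu' : ℕ} (lam<k : lam ℕ.< k)
  (valency : suc (k ℕ.+ k') ≡ v) (mu-eq : k ℕ.+ k ℕ.+ mu' ≡ v ℕ.+ lam) where

  +k'≡v-k-1 : + k' ≡ + v - + k - + 1
  +k'≡v-k-1 rewrite sym valency = cancel (+ k) (+ k')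
    where
    cancel : ∀ K K' → K' ≡ + 1 + (K + K') - K - + 1
    cancel = solve-∀

  +mu'≡v-2k+lam : + mu' ≡ + v - + 2 * + k + + lam
  +mu'≡v-2k+lam = begin
    + mu'                           ≡⟨ cancel (+ k) (+ mu') ⟩
    + (k ℕ.+ k ℕ.+ mu') - + 2 * + k ≡⟨ cong (λ n → + n - + 2 * + k) mu-eq ⟩
    + (v ℕ.+ lam) - + 2 * + k       ≡⟨ regroup (+ v) (+ lam) (+ k) ⟩
    + v - + 2 * + k + + lam         ∎
    where
    open ≡-Reasoning
    cancel : ∀ K M → M ≡ K + K + M - + 2 * K
    cancel = solve-∀
    regroup : ∀ V L K → V + L - + 2 * K ≡ V - + 2 * K + L
    regroup = solve-∀

  R≡C : ∀ x y → R v k' lam' mu' x y 0ℤ ≡ C v k lam (y - x - + 1) y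
  R≡C x y = trans (cong₂ (λ K' M' → Rℤ (+ v) K' (+ lam') M' x y 0ℤ) +k'≡v-k-1 +mu'≡v-2k+lam)
                  (R-complement≡C (+ v) (+ k) (+ lam) (+ lam') x y)

  k<v : k ℕ.< v
  k<v = subst (k ℕ.<_) valency (s≤s (ℕ.m≤m+n k k'))

  open CliqueAdjacency lam<k k<v (subst (k ℕ.+ k ℕ.≤_) mu-eq (ℕ.m≤m+n (k ℕ.+ k) mu'))

  R-nonNeg⇔nonNegC : ∀ {y} → (∀ x → 0ℤ ≤ R v k' lam' mu' x (+ y) 0ℤ) ⇔ NonNegC y
  R-nonNeg⇔nonNegC {y} = mk⇔ to from
    where
    involutive : ∀ Y m → Y - (Y - m - + 1) - + 1 ≡ m
    involutive = solve-∀
    C≡R : ∀ m → C v k lam m (+ y) ≡ R v k' lam' mu' (+ y - m - + 1) (+ y) 0ℤ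
    C≡R m = sym (trans (R≡C (+ y - m - + 1) (+ y)) (cong (λ z → C v k lam z (+ y)) (involutive (+ y) m)))
    to : (∀ x → 0ℤ ≤ R v k' lam' mu' x (+ y) 0ℤ) → NonNegC y
    to R-nonNeg m = subst (0ℤ ≤_) (sym (C≡R m)) (R-nonNeg (+ y - m - + 1))
    from : NonNegC y → ∀ x → 0ℤ ≤ R v k' lam' mu' x (+ y) 0ℤ
    from nonNeg x = subst (0ℤ ≤_) (sym (R≡C x (+ y))) (nonNeg (+ y - x - + 1))

  cab∈S0 : ∀ {c} → IsCAB v k lam c → InS0 v k' lam' mu' c
  cab∈S0 cab@(2≤c , _) =
    ℕ.≤-trans (s≤s z≤n) 2≤c ,
    ℕ.≤-trans (nonNegC-bounded (cab-nonNegC cab)) (ℕ.≤-trans 2+lam≤1+k k<v) ,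
    Equivalence.from R-nonNeg⇔nonNegC (cab-nonNegC cab)

  S0-bounded-by-cab : ∀ {c y} → IsCAB v k lam c → InS0 v k' lam' mu' y → y ℕ.≤ c
  S0-bounded-by-cab cab (_ , _ , R-nonNeg) = cab-maximal cab (Equivalence.to R-nonNeg⇔nonNegC R-nonNeg)

  rab⇒cab : ∀ {c n} → IsCAB v k lam c → IsRab0 v k' lam' mu' n → IsCAB v k lam n
  rab⇒cab cab (inj₁ (n∈S0 , S0≤n)) =
    subst (IsCAB v k lam) (ℕ.≤-antisym (S0≤n _ (cab∈S0 cab)) (S0-bounded-by-cab cab n∈S0)) cab
  rab⇒cab cab (inj₂ (_ , S0-empty)) = ⊥-elim (S0-empty _ (cab∈S0 cab))

  rab⇔cab : ∀ n → IsRab0 v k' lam' mu' n ⇔ IsCAB v k lam n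
  rab⇔cab n = mk⇔ (rab⇒cab (proj₂ cab-exists)) (λ cab → inj₁ (cab∈S0 cab , λ y → S0-bounded-by-cab cab))

proposition7p1 : (v k lam mu : ℕ) (G : Graph v) → IsSRG G k lam mu →
    (k' lam' mu' : ℕ) → IsSRG (complement G) k' lam' mu' →
      (∀ (x y : ℤ) → R v k' lam' mu' x y (+ 0) ≡ C v k lam (y - x - + 1) y)
      × (∀ (n : ℕ) → IsRab0 v k' lam' mu' n ⇔ IsCAB v k lam n)
proposition7p1 v k lam mu G srg k' lam' mu' srg' =
  R≡C (lam<k srg) valency mu-eq , rab⇔cab (lam<k srg) valency mu-eq
  where
  valency : suc (k ℕ.+ k') ≡ v
  valency = complement-valency srg srg'
  mu-eq : k ℕ.+ k ℕ.+ mu' ≡ v ℕ.+ lam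
  mu-eq = complement-mu srg srg'
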